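{- If $\Gamma$ is an imprimitive finite simple graph such that $\mathrm{Aut}(\Gamma)$ is a simple group, then $\mathrm{Aut}(\Gamma)$ does not admit a factorizing block system.
   Context: Permutations of an $n$-element set are identified with $n\times n$ permutation matrices; $J_n$ is the all-ones matrix; the Schur product is the entrywise product, two permutations being orthogonal if their Schur product is zero. A group $G$ acting on a set $X$ with $|X|=n$ is uniformly transitive if there is a subset $\{\sigma_1,\ldots,\sigma_n\}\subset G$ of size $n$ with $\sum_i\sigma_i=J_n$. For $G$ acting transitively on $X$, a block is a subset $B\subset X$ with $gB=B$ or $gB\cap B=\emptyset$ for all $g\in G$; it is nontrivial if $1<|B|<|X|$. A graph is imprimitive if $\mathrm{Aut}(\Gamma)$ acts transitively on $V(\Gamma)$ with a nontrivial block. The block system of a block $B$ is $\mathcal{B}=\{gB:g\in G\}$, a partition into $m$ blocks of size $k$. The fixer $\mathrm{fix}_\Gamma(\mathcal{B})$ is the kernel of $\mathrm{Aut}(\Gamma)\to\mathrm{Sym}(\mathcal{B})$. A nontrivial block system $\mathcal{B}$ with blocks of size $k$ is factorizing if (i) $\mathrm{fix}_\Gamma(\mathcal{B})$ contains $k$ pairwise Schur-orthogonal elements, and (ii) $\mathrm{Aut}(\Gamma)/\mathrm{fix}_\Gamma(\mathcal{B})$ acts uniformly transitively on $\mathcal{B}$. -}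

module Defs where

open import Data.Nat using (ℕ; _<_; _*_)
open import Data.Bool using (Bool)
open import Data.Fin using (Fin)
open import Data.Fin.Subset using (Subset; _∈_; _∉_; ∣_∣)
open import Data.Fin.Permutation using (Permutation′; _⟨$⟩ʳ_; _≈_; id; flip; _∘ₚ_)
open import Data.Product using (Σ; ∃; ∃-syntax; _×_)
open import Data.Sum using (_⊎_)
open import Data.Empty using (⊥)
open import Relation.Nullary using (¬_)
open import Relation.Binary.PropositionalEquality using (_≡_; _≢_)
open import Function.Bundles using (_⇔_)

record Graph (n : ℕ) : Set where
  field
    adj   : Fin n → Fin n → Bool
    sym   : ∀ x y → adj x y ≡ adj y x
    irrefl : ∀ x → adj x x ≡ Data.Bool.false
open Graph public

Perm : ℕ → Set
Perm n = Permutation′ n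

IsAut : ∀ {n} → Graph n → Perm n → Set
IsAut Γ σ = ∀ x y → adj Γ (σ ⟨$⟩ʳ x) (σ ⟨$⟩ʳ y) ≡ adj Γ x y

record IsNormalSubgroupOfAut {n} (Γ : Graph n) (N : Perm n → Set) : Set where
  field
    respects : ∀ σ τ → σ ≈ τ → N σ → N τ
    ⊆Aut     : ∀ σ → N σ → IsAut Γ σ
    has-id   : N id
    ∘-closed : ∀ σ τ → N σ → N τ → N (σ ∘ₚ τ)
    ⁻¹-closed : ∀ σ → N σ → N (flip σ)
    conj-closed : ∀ g σ → IsAut Γ g → N σ → N (flip g ∘ₚ σ ∘ₚ g)

AutSimple : ∀ {n} → Graph n → Set₁
AutSimple {n} Γ =
  (∃[ σ ] (IsAut Γ σ × ¬ (σ ≈ id))) ×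
  (∀ (N : Perm n → Set) → IsNormalSubgroupOfAut Γ N →
     (∀ σ → N σ → σ ≈ id) ⊎ (∀ σ → IsAut Γ σ → N σ))

VertexTransitive : ∀ {n} → Graph n → Set
VertexTransitive Γ = ∀ x y → ∃[ σ ] (IsAut Γ σ × σ ⟨$⟩ʳ x ≡ y)

_∈Img_·_ : ∀ {n} → Fin n → Perm n → Subset n → Set
y ∈Img σ · B = ∃[ x ] (x ∈ B × σ ⟨$⟩ʳ x ≡ y)

IsBlock : ∀ {n} → Graph n → Subset n → Set
IsBlock Γ B = ∀ g → IsAut Γ g →
  (∀ y → (y ∈Img g · B) ⇔ (y ∈ B)) ⊎ (∀ y → ¬ ((y ∈Img g · B) × y ∈ B))

Nontrivial : ∀ {n} → Subset n → Set
Nontrivial {n} B = 1 < ∣ B ∣ × ∣ B ∣ < n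

Imprimitive : ∀ {n} → Graph n → Set
Imprimitive Γ = VertexTransitive Γ × ∃[ B ] (IsBlock Γ B × Nontrivial B)

-- The block system of B is {hB : h ∈ Aut(Γ)}.  Equality of the blocks
-- g(hB) and h'B as vertex sets:
SameBlock : ∀ {n} → Subset n → Perm n → Perm n → Perm n → Set
SameBlock B g h h' =
  ∀ y → (∃[ x ] (x ∈ B × g ⟨$⟩ʳ (h ⟨$⟩ʳ x) ≡ y)) ⇔ (y ∈Img h' · B)

InFixer : ∀ {n} → Graph n → Subset n → Perm n → Set
InFixer Γ B g = IsAut Γ g × (∀ h → IsAut Γ h → SameBlock B g h h)

-- Schur product of the permutation matrices of σ and τ is zero.
SchurOrthogonal : ∀ {n} → Perm n → Perm n → Set
SchurOrthogonal σ τ = ∀ x → σ ⟨$⟩ʳ x ≢ τ ⟨$⟩ʳ x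

FixerCondition : ∀ {n} → Graph n → Subset n → Set
FixerCondition Γ B =
  Σ (Fin ∣ B ∣ → Perm _) λ σ → ((∀ (i : Fin ∣ B ∣) → InFixer Γ B (σ i)) ×
          (∀ i j → i ≢ j → SchurOrthogonal (σ i) (σ j)))

-- (ii) Aut(Γ)/fix(𝓑) acts uniformly transitively on 𝓑, where 𝓑 has
-- m blocks (m · |B| = n): there are m elements g₁,…,gₘ of the quotient
-- (represented by automorphisms) whose induced permutation matrices on 𝓑
-- sum to J_m, i.e. for every pair of blocks C = h₁B, D = h₂B exactly one i
-- has gᵢ C = D.
QuotientUniformlyTransitive : ∀ {n} → Graph n → Subset n → Set
QuotientUniformlyTransitive {n} Γ B =
  Σ ℕ λ m → (m * ∣ B ∣ ≡ n) ×
    Σ (Fin m → Perm n) λ g → ((∀ (i : Fin m) → IsAut Γ (g i)) ×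
      (∀ (h₁ h₂ : Perm n) → IsAut Γ h₁ → IsAut Γ h₂ →
         Σ (Fin m) λ i → (SameBlock B (g i) h₁ h₂ ×
                 (∀ j → SameBlock B (g j) h₁ h₂ → j ≡ i))))

Factorizing : ∀ {n} → Graph n → Subset n → Set
Factorizing Γ B = FixerCondition Γ B × QuotientUniformlyTransitive Γ B

module Submission where

-- The fixer fix(𝓑) of the block system of B is the kernel of
-- the action of Aut(Γ) on the blocks, hence a normal subgroup of Aut(Γ).
-- If Aut(Γ) is simple, the fixer is either trivial or all of Aut(Γ):
--   * trivial fixer: condition (i) asks for |B| ≥ 2 pairwise
--     Schur-orthogonal elements of the fixer, but two copies of the
--     identity agree at every vertex;
--   * full fixer: every automorphism maps B to itself, so all the
--     representatives g₁,…,gₘ of condition (ii) send B to B and uniqueness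
--     forces m = 1; then n = m·|B| = |B|, contradicting |B| < n.

open import Defs hiding (sym)
open import Data.Nat using (ℕ; zero; suc; _<_; _*_; s≤s)
open import Data.Nat.Properties using (*-identityˡ; <-irrefl)
open import Data.Fin using (Fin; fromℕ<) renaming (zero to fzero; suc to fsuc)
open import Data.Fin.Subset using (Subset; _∈_; ∣_∣)
open import Data.Fin.Permutation using (_⟨$⟩ʳ_; _⟨$⟩ˡ_; _≈_; id; flip; _∘ₚ_; inverseˡ; inverseʳ)
open import Data.Product using (∃-syntax; _×_; _,_; proj₁; proj₂)
open import Data.Sum using (inj₁; inj₂)
open import Relation.Nullary using (¬_)
open import Relation.Binary.PropositionalEquality using (_≡_; _≢_; refl; sym; trans; cong; cong₂; subst; subst₂; module ≡-Reasoning)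
open import Function.Bundles using (_⇔_; mk⇔; Equivalence)

module Stabilisers {n : ℕ} where

  MapsInto : Perm n → (Fin n → Set) → Set
  MapsInto σ C = ∀ {y} → C y → C (σ ⟨$⟩ʳ y)

  Stabilises : Perm n → (Fin n → Set) → Set
  Stabilises σ C = MapsInto σ C × MapsInto (flip σ) C

  stabilises-id : ∀ C → Stabilises id C
  stabilises-id C = (λ c → c) , (λ c → c)

  stabilises-∘ : ∀ σ τ C → Stabilises σ C → Stabilises τ C → Stabilises (σ ∘ₚ τ) C
  stabilises-∘ σ τ C (σ⁺ , σ⁻) (τ⁺ , τ⁻) = (λ c → τ⁺ (σ⁺ c)) , (λ c → σ⁻ (τ⁻ c))

  stabilises-flip : ∀ σ C → Stabilises σ C → Stabilises (flip σ) C
  stabilises-flip σ C (σ⁺ , σ⁻) = σ⁻ , σ⁺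

  flip-≈ : ∀ (σ τ : Perm n) → σ ≈ τ → flip σ ≈ flip τ
  flip-≈ σ τ σ≈τ y = begin
    σ ⟨$⟩ˡ y                     ≡⟨ cong (σ ⟨$⟩ˡ_) (sym (inverseʳ τ)) ⟩
    σ ⟨$⟩ˡ (τ ⟨$⟩ʳ (τ ⟨$⟩ˡ y))    ≡⟨ cong (σ ⟨$⟩ˡ_) (sym (σ≈τ (τ ⟨$⟩ˡ y))) ⟩
    σ ⟨$⟩ˡ (σ ⟨$⟩ʳ (τ ⟨$⟩ˡ y))    ≡⟨ inverseˡ σ ⟩
    τ ⟨$⟩ˡ y                     ∎
    where open ≡-Reasoning

  mapsInto-≈ : ∀ (σ τ : Perm n) C → σ ≈ τ → MapsInto σ C → MapsInto τ C
  mapsInto-≈ σ τ C σ≈τ σ⁺ {y} c = subst C (σ≈τ y) (σ⁺ c)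

  stabilises-≈ : ∀ (σ τ : Perm n) C → σ ≈ τ → Stabilises σ C → Stabilises τ C
  stabilises-≈ σ τ C σ≈τ (σ⁺ , σ⁻) =
    mapsInto-≈ σ τ C σ≈τ σ⁺ , mapsInto-≈ (flip σ) (flip τ) C (flip-≈ σ τ σ≈τ) σ⁻

  stabilises-⇔ : ∀ σ C D → (∀ y → C y ⇔ D y) → Stabilises σ C → Stabilises σ D
  stabilises-⇔ σ C D C⇔D (σ⁺ , σ⁻) =
    (λ d → to (σ⁺ (from d))) , (λ d → to (σ⁻ (from d)))
    where
    to : ∀ {y} → C y → D y
    to {y} = Equivalence.to (C⇔D y)
    from : ∀ {y} → D y → C y
    from {y} = Equivalence.from (C⇔D y)

  -- Conjugation transports stabilisers: if σ maps g⁻¹C into itself, then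
  -- gσg⁻¹ maps C into itself (_∘ₚ_ composes left to right, so
  -- flip g ∘ₚ σ ∘ₚ g is x ↦ g(σ(g⁻¹x))).
  mapsInto-conj : ∀ g σ C → MapsInto σ (λ y → C (g ⟨$⟩ʳ y)) →
                  MapsInto (flip g ∘ₚ σ ∘ₚ g) C
  mapsInto-conj g σ C σ⁺ {y} c = σ⁺ (subst C (sym (inverseʳ g)) c)

  stabilises-conj : ∀ g σ C → Stabilises σ (λ y → C (g ⟨$⟩ʳ y)) →
                    Stabilises (flip g ∘ₚ σ ∘ₚ g) C
  stabilises-conj g σ C (σ⁺ , σ⁻) =
    mapsInto-conj g σ C σ⁺ , mapsInto-conj g (flip σ) C σ⁻

open Stabilisers

module Automorphisms {n : ℕ} (Γ : Graph n) where

  aut-id : IsAut Γ id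
  aut-id x y = refl

  aut-∘ : ∀ σ τ → IsAut Γ σ → IsAut Γ τ → IsAut Γ (σ ∘ₚ τ)
  aut-∘ σ τ σ-aut τ-aut x y = trans (τ-aut (σ ⟨$⟩ʳ x) (σ ⟨$⟩ʳ y)) (σ-aut x y)

  aut-flip : ∀ σ → IsAut Γ σ → IsAut Γ (flip σ)
  aut-flip σ σ-aut x y =
    trans (sym (σ-aut (σ ⟨$⟩ˡ x) (σ ⟨$⟩ˡ y))) (cong₂ (adj Γ) (inverseʳ σ) (inverseʳ σ))

  aut-≈ : ∀ (σ τ : Perm n) → σ ≈ τ → IsAut Γ σ → IsAut Γ τ
  aut-≈ σ τ σ≈τ σ-aut x y =
    subst₂ (λ a b → adj Γ a b ≡ adj Γ x y) (σ≈τ x) (σ≈τ y) (σ-aut x y)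

open Automorphisms

module Fixer {n : ℕ} (Γ : Graph n) (B : Subset n) where

  blockOf : Perm n → Fin n → Set
  blockOf h y = y ∈Img h · B

  sameBlock⇒stabilises : ∀ σ h → SameBlock B σ h h → Stabilises σ (blockOf h)
  sameBlock⇒stabilises σ h σhB≡hB = into , back
    where
    into : MapsInto σ (blockOf h)
    into (x , x∈B , hx≡y) = Equivalence.to (σhB≡hB _) (x , x∈B , cong (σ ⟨$⟩ʳ_) hx≡y)
    back : MapsInto (flip σ) (blockOf h)
    back y∈hB with Equivalence.from (σhB≡hB _) y∈hB
    ... | x , x∈B , σhx≡y = x , x∈B , trans (sym (inverseˡ σ)) (cong (σ ⟨$⟩ˡ_) σhx≡y)

  stabilises⇒sameBlock : ∀ σ h → Stabilises σ (blockOf h) → SameBlock B σ h h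
  stabilises⇒sameBlock σ h (σ⁺ , σ⁻) y = mk⇔ into back
    where
    into : (∃[ x ] (x ∈ B × σ ⟨$⟩ʳ (h ⟨$⟩ʳ x) ≡ y)) → blockOf h y
    into (x , x∈B , σhx≡y) = subst (blockOf h) σhx≡y (σ⁺ (x , x∈B , refl))
    back : blockOf h y → ∃[ x ] (x ∈ B × σ ⟨$⟩ʳ (h ⟨$⟩ʳ x) ≡ y)
    back y∈hB with σ⁻ y∈hB
    ... | x , x∈B , hx≡σ⁻¹y = x , x∈B , trans (cong (σ ⟨$⟩ʳ_) hx≡σ⁻¹y) (inverseʳ σ)

  blockOf-shift : ∀ h g y → blockOf (h ∘ₚ flip g) y ⇔ blockOf h (g ⟨$⟩ʳ y)
  blockOf-shift h g y = mk⇔ into back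
    where
    into : blockOf (h ∘ₚ flip g) y → blockOf h (g ⟨$⟩ʳ y)
    into (x , x∈B , g⁻¹hx≡y) = x , x∈B , trans (sym (inverseʳ g)) (cong (g ⟨$⟩ʳ_) g⁻¹hx≡y)
    back : blockOf h (g ⟨$⟩ʳ y) → blockOf (h ∘ₚ flip g) y
    back (x , x∈B , hx≡gy) = x , x∈B , trans (cong (g ⟨$⟩ˡ_) hx≡gy) (inverseˡ g)

  FixesBlocks : Perm n → Set
  FixesBlocks σ = ∀ h → IsAut Γ h → Stabilises σ (blockOf h)

  fixesBlocks : ∀ σ → InFixer Γ B σ → FixesBlocks σ
  fixesBlocks σ (_ , fix) h h-aut = sameBlock⇒stabilises σ h (fix h h-aut)

  inFixer : ∀ σ → IsAut Γ σ → FixesBlocks σ → InFixer Γ B σ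
  inFixer σ σ-aut fix = σ-aut , λ h h-aut → stabilises⇒sameBlock σ h (fix h h-aut)

  fixer-normal : IsNormalSubgroupOfAut Γ (InFixer Γ B)
  fixer-normal = record
    { respects    = λ σ τ σ≈τ σ-fix → inFixer τ (aut-≈ Γ σ τ σ≈τ (proj₁ σ-fix))
        λ h h-aut → stabilises-≈ σ τ _ σ≈τ (fixesBlocks σ σ-fix h h-aut)
    ; ⊆Aut        = λ σ → proj₁
    ; has-id      = inFixer id (aut-id Γ) λ h _ → stabilises-id (blockOf h)
    ; ∘-closed    = λ σ τ σ-fix τ-fix →
        inFixer (σ ∘ₚ τ) (aut-∘ Γ σ τ (proj₁ σ-fix) (proj₁ τ-fix)) λ h h-aut →
          stabilises-∘ σ τ _ (fixesBlocks σ σ-fix h h-aut) (fixesBlocks τ τ-fix h h-aut)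
    ; ⁻¹-closed   = λ σ σ-fix → inFixer (flip σ) (aut-flip Γ σ (proj₁ σ-fix)) λ h h-aut →
        stabilises-flip σ _ (fixesBlocks σ σ-fix h h-aut)
    ; conj-closed = conj-closed
    }
    where
    -- gσg⁻¹ fixes hB because σ fixes (h g⁻¹)B = g⁻¹(hB).
    conj-closed : ∀ g σ → IsAut Γ g → InFixer Γ B σ → InFixer Γ B (flip g ∘ₚ σ ∘ₚ g)
    conj-closed g σ g-aut σ-fix =
      inFixer (flip g ∘ₚ σ ∘ₚ g)
        (aut-∘ Γ (flip g) (σ ∘ₚ g) (aut-flip Γ g g-aut) (aut-∘ Γ σ g (proj₁ σ-fix) g-aut))
        λ h h-aut →
          stabilises-conj g σ (blockOf h)
            (stabilises-⇔ σ _ _ (blockOf-shift h g)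
              (fixesBlocks σ σ-fix (h ∘ₚ flip g) (aut-∘ Γ h (flip g) h-aut (aut-flip Γ g g-aut))))

open Fixer

distinct-pair : ∀ {k} → 1 < k → ∃[ i ] ∃[ j ] (_≢_ {A = Fin k} i j)
distinct-pair (s≤s (s≤s _)) = fzero , fsuc fzero , λ ()

unique-index : ∀ {m} (i : Fin m) → (∀ j → j ≡ i) → m ≡ 1
unique-index {suc zero}    _ _       = refl
unique-index {suc (suc _)} i all-≡i with trans (all-≡i fzero) (sym (all-≡i (fsuc fzero)))
... | ()

identities-not-orthogonal : ∀ {n} → Fin n → (σ τ : Perm n) → σ ≈ id → τ ≈ id →
                            ¬ SchurOrthogonal σ τ
identities-not-orthogonal v σ τ σ≈id τ≈id σ⊥τ = σ⊥τ v (trans (σ≈id v) (sym (τ≈id v)))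

trivial-fixer-¬condition : ∀ {n} (Γ : Graph n) (B : Subset n) → Fin n → 1 < ∣ B ∣ →
  (∀ σ → InFixer Γ B σ → σ ≈ id) → ¬ FixerCondition Γ B
trivial-fixer-¬condition Γ B v 1<∣B∣ trivial (σ , σ-fix , σ-orth)
  with distinct-pair 1<∣B∣
... | i , j , i≢j =
  identities-not-orthogonal v (σ i) (σ j)
    (trivial (σ i) (σ-fix i)) (trivial (σ j) (σ-fix j)) (σ-orth i j i≢j)

full-fixer-¬uniform : ∀ {n} (Γ : Graph n) (B : Subset n) → ∣ B ∣ < n →
  (∀ g → IsAut Γ g → InFixer Γ B g) → ¬ QuotientUniformlyTransitive Γ B
full-fixer-¬uniform {n} Γ B ∣B∣<n full (m , m*∣B∣≡n , g , g-aut , unique)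
  with unique id id (aut-id Γ) (aut-id Γ)
... | i , _ , only-i = <-irrefl ∣B∣≡n ∣B∣<n
  where
  -- Each gⱼ maps B = id B to itself, so j is the unique index i.
  m≡1 : m ≡ 1
  m≡1 = unique-index i λ j → only-i j (proj₂ (full (g j) (g-aut j)) id (aut-id Γ))

  ∣B∣≡n : ∣ B ∣ ≡ n
  ∣B∣≡n = trans (sym (*-identityˡ ∣ B ∣)) (subst (λ k → k * ∣ B ∣ ≡ n) m≡1 m*∣B∣≡n)

proposition4p6 : ∀ (n : ℕ) (Γ : Graph n) → Imprimitive Γ → AutSimple Γ →
    ∀ (B : Subset n) → IsBlock Γ B → Nontrivial B → ¬ Factorizing Γ B
proposition4p6 n Γ _ (_ , simple) B _ (1<∣B∣ , ∣B∣<n) (condition , uniform)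
  with simple (InFixer Γ B) (fixer-normal Γ B)
... | inj₁ trivial = trivial-fixer-¬condition Γ B (fromℕ< ∣B∣<n) 1<∣B∣ trivial condition
... | inj₂ full    = full-fixer-¬uniform Γ B ∣B∣<n full uniform
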